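{- Let $\ell>1$ be an integer. For integers $n\ge\ell$ and $k\ge1$, let $f^{(\ell)}_{n,k}$ be the number of fixed points of $\big((1\,2\,\cdots\,\ell)\big)^{\odot k}$, where $(1\,2\,\cdots\,\ell)\in\mathfrak{S}_n$ is the $\ell$-cycle fixing $\ell+1,\dots,n$. Then for all $k\ge1$, $n\ge\ell$: $$f^{(\ell)}_{n,k}=\begin{cases} n-\ell & \text{if } k=1,\\ 1 & \text{if } n=\ell \text{ and } k\equiv 0 \pmod{\ell},\\ 0 & \text{if } n=\ell \text{ and } k\not\equiv 0\pmod{\ell},\\ f^{(\ell)}_{n-1,k}+f^{(\ell)}_{n,k-1} & \text{otherwise (i.e. } k>1,\ n>\ell).\end{cases}$$
   Context: For positive integers $n,k$, let $\mathcal{C}_{n,k}$ be the set of weakly increasing $k$-tuples $(i_1\le\cdots\le i_k)$ with entries in $[n]$ (equivalently, $k$-element multisets from $[n]$). For $\sigma\in\mathfrak{S}_n$, the $k$-th symmetric tensor power $\sigma^{\odot k}$ is the permutation of $\mathcal{C}_{n,k}$ sending $(i_1,\dots,i_k)$ to the weakly increasing rearrangement of $(\sigma(i_1),\dots,\sigma(i_k))$ (equivalently, the permutation given by the $k$-th symmetric tensor power of the permutation matrix of $\sigma$). -}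

module Defs where

open import Data.Nat using (ℕ; zero; suc; _≤?_; _<?_; _≟_)
open import Data.Nat.Properties using (≤-decTotalOrder)
open import Data.List using (List; []; _∷_; map; concatMap; filter; length; applyUpTo)
open import Data.List.Properties using (≡-dec)
open import Data.List.Relation.Unary.Linked using (Linked; linked?)
open import Data.List.Sort.Base using (SortingAlgorithm)
open import Data.List.Sort.MergeSort ≤-decTotalOrder using (mergeSort)
open import Relation.Nullary using (Dec; does)
open import Data.Bool using (if_then_else_)
import Data.Nat as N

range : ℕ → List ℕ
range n = applyUpTo suc n

cycle : ℕ → ℕ → ℕ
cycle ℓ i =
  if does (1 N.≤? i) then
    (if does (i <? ℓ) then suc i else (if does (i ≟ ℓ) then 1 else i))
  else i

tuples : ℕ → ℕ → List (List ℕ)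
tuples n zero = [] ∷ []
tuples n (suc k) = concatMap (λ i → map (i ∷_) (tuples n k)) (range n)

WeaklyIncreasing : List ℕ → Set
WeaklyIncreasing = Linked N._≤_

C : ℕ → ℕ → List (List ℕ)
C n k = filter (linked? N._≤?_) (tuples n k)

sortℕ : List ℕ → List ℕ
sortℕ = SortingAlgorithm.sort mergeSort

symPow : (ℕ → ℕ) → List ℕ → List ℕ
symPow σ t = sortℕ (map σ t)

f : ℕ → ℕ → ℕ → ℕ
f ℓ n k = length (filter (λ t → ≡-dec _≟_ (symPow (cycle ℓ) t) t) (C n k))

-- A weakly increasing k-tuple is a k-multiset. One over [m+1] either avoids m+1 or is a
-- (k-1)-multiset over [m+1] followed by m+1; when m ≥ ℓ the cycle fixes m+1, so fixed points
-- split the same way, which is the recursion. For n = ℓ, encode a multiset over [ℓ] by its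
-- multiplicity vector (c₁, …, c_ℓ): the ℓ-cycle rotates this vector, so the fixed points are
-- the constant vectors, i.e. the single multiset 1^b 2^b ⋯ ℓ^b when k = bℓ and none otherwise.
-- The case k = 1 then follows from the recursion, started at f_{ℓ,1} = 0 and f_{n,0} = 1.
-- Counting is done up to permutation: 𝒞_{n,k} has no repetitions, so two such lists with the
-- same members are permutations of each other.
module Submission where

open import Defs
open import Data.Bool using (true; false)
open import Data.Empty using (⊥-elim)
open import Data.List using (List; []; _∷_; _++_; _∷ʳ_; map; concatMap; cartesianProductWith; filter; length; replicate; initLast; _∷ʳ′_)
open import Data.List.Properties using (≡-dec; ∷-injective; ∷-injectiveˡ; ∷-injectiveʳ; ∷ʳ-injectiveˡ; map-++; map-replicate; map-cong-local; filter-++; filter-none; length-++; length-map; length-replicate; ++-assoc; ++-identityʳ)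
open import Data.List.Membership.Propositional using (_∈_)
open import Data.List.Membership.Propositional.Properties using (∈-applyUpTo⁺; ∈-applyUpTo⁻; ∈-cartesianProductWith⁺; ∈-cartesianProductWith⁻; ∈-filter⁺; ∈-filter⁻; ∈-++⁺ˡ; ∈-++⁺ʳ; ∈-++⁻; ∈-map⁺; ∈-map⁻)
open import Data.List.Membership.Propositional.Properties.WithK using (unique∧set⇒bag)
open import Data.List.Relation.Binary.BagAndSetEquality using (∼bag⇒↭)
open import Data.List.Relation.Binary.Equality.Propositional using (≋⇒≡)
open import Data.List.Relation.Binary.Permutation.Propositional using (_↭_; ↭-sym; ↭-trans; ↭-reflexive; ↭⇒↭ₛ; module PermutationReasoning)
import Data.List.Relation.Binary.Permutation.Propositional.Properties as ↭
open import Data.List.Relation.Unary.All using (All; []; _∷_)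
import Data.List.Relation.Unary.All as All
open import Data.List.Relation.Unary.All.Properties using (++⁺; ++⁻ʳ; ∷ʳ⁺; ∷ʳ⁻; replicate⁺)
import Data.List.Relation.Unary.AllPairs as AllPairs
open import Data.List.Relation.Unary.Any using (here)
open import Data.List.Relation.Unary.Linked using (Linked; []; [-]; _∷_; linked?)
import Data.List.Relation.Unary.Linked as Linked
open import Data.List.Relation.Unary.Linked.Properties using (Linked⇒AllPairs)
open import Data.List.Relation.Unary.Sorted.TotalOrder.Properties using (↗↭↗⇒≋)
open import Data.List.Relation.Unary.Unique.Propositional using (Unique)
import Data.List.Relation.Unary.Unique.Propositional.Properties as Unique
open import Data.List.Sort.Base using (SortingAlgorithm)
open import Data.Nat using (ℕ; zero; suc; _+_; _*_; _∸_; _≤_; _<_; z≤n; s≤s; _≤?_; _<?_; _≟_)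
open import Data.Nat.Divisibility using (_∣_; divides; ∣1⇒≡1)
open import Data.Nat.Properties using (≤-decTotalOrder; ≤-refl; ≤-trans; ≤-pred; ≤-totalOrder; <-irrefl; <-asym; <⇒≢; ≤∧≢⇒<; n≤1+n; m≤m+n; m≤n+m; m∸n+n≡m; suc-injective; +-comm; +-suc; +-identityʳ; *-zeroʳ; *-suc; *-cancelʳ-≡)
open import Data.List.Sort.MergeSort ≤-decTotalOrder using (mergeSort)
open import Data.Product using (_×_; _,_; proj₁; proj₂; ∃-syntax)
open import Data.Sum using (_⊎_; inj₁; inj₂)
open import Function using (_∘_; _⇔_; mk⇔; Equivalence)
open import Relation.Binary using (Rel; Transitive)
open import Relation.Binary.PropositionalEquality using (_≡_; refl; cong; cong₂; sym; trans; subst; module ≡-Reasoning)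
open import Relation.Nullary using (yes; no; does; ¬_)
open import Relation.Nullary.Decidable using (dec-true; dec-false)
open import Relation.Unary using (Pred; Decidable)

unique∧set⇒↭ : ∀ {a} {A : Set a} {xs ys : List A} → Unique xs → Unique ys → (∀ {x} → x ∈ xs ⇔ x ∈ ys) → xs ↭ ys
unique∧set⇒↭ xs-unique ys-unique same = ∼bag⇒↭ (unique∧set⇒bag xs-unique ys-unique same)

concatMap-map≡cartesianProductWith : ∀ {a b c} {A : Set a} {B : Set b} {D : Set c} (f : A → B → D) xs ys →
  concatMap (λ x → map (f x) ys) xs ≡ cartesianProductWith f xs ys
concatMap-map≡cartesianProductWith f [] ys = refl
concatMap-map≡cartesianProductWith f (x ∷ xs) ys =
  cong (map (f x) ys ++_) (concatMap-map≡cartesianProductWith f xs ys)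

module _ {a b p q} {A : Set a} {B : Set b} {P : Pred B p} {Q : Pred A q} (P? : Decidable P) (Q? : Decidable Q) where

  filter-map-⇔ : ∀ (g : A → B) {xs} → All (λ x → P (g x) ⇔ Q x) xs → filter P? (map g xs) ≡ map g (filter Q? xs)
  filter-map-⇔ g [] = refl
  filter-map-⇔ g {x ∷ xs} (Pgx⇔Qx ∷ rest) with P? (g x) | Q? x
  ... | yes _ | yes _ = cong (g x ∷_) (filter-map-⇔ g rest)
  ... | no _ | no _ = filter-map-⇔ g rest
  ... | yes Pgx | no ¬Qx = ⊥-elim (¬Qx (Equivalence.to Pgx⇔Qx Pgx))
  ... | no ¬Pgx | yes Qx = ⊥-elim (¬Pgx (Equivalence.from Pgx⇔Qx Qx))

module _ {a} {A : Set a} where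

  length-∷ʳ : ∀ (u : List A) x → length (u ∷ʳ x) ≡ suc (length u)
  length-∷ʳ u x = trans (length-++ u) (+-comm (length u) 1)

  replicate-∷ʳ : ∀ n (x : A) → replicate n x ∷ʳ x ≡ x ∷ replicate n x
  replicate-∷ʳ zero x = refl
  replicate-∷ʳ (suc n) x = cong (x ∷_) (replicate-∷ʳ n x)

  ∷≡∷ʳ⇒replicate : ∀ (c : A) v → c ∷ v ≡ v ∷ʳ c → c ∷ v ≡ replicate (suc (length v)) c
  ∷≡∷ʳ⇒replicate c [] _ = refl
  ∷≡∷ʳ⇒replicate c (y ∷ v) eq with refl ← ∷-injectiveˡ eq =
    cong (c ∷_) (∷≡∷ʳ⇒replicate c v (∷-injectiveʳ eq))

module _ {a r} {A : Set a} {R : Rel A r} where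

  ∷-linked⁺ : ∀ {x xs} → All (R x) xs → Linked R xs → Linked R (x ∷ xs)
  ∷-linked⁺ [] [] = [-]
  ∷-linked⁺ (r ∷ _) l = r ∷ l

module _ {a r} {A : Set a} {R : Rel A r} (R-trans : Transitive R) where

  ∷-linked⇒All : ∀ {x xs} → Linked R (x ∷ xs) → All (R x) xs
  ∷-linked⇒All l with x≤xs AllPairs.∷ _ ← Linked⇒AllPairs R-trans l = x≤xs

  ∷ʳ-linked⁺ : ∀ {x u} → Linked R u → All (λ y → R y x) u → Linked R (u ∷ʳ x)
  ∷ʳ-linked⁺ [] [] = [-]
  ∷ʳ-linked⁺ [-] (r ∷ []) = r ∷ [-]
  ∷ʳ-linked⁺ (r ∷ l) (_ ∷ rs) = r ∷ ∷ʳ-linked⁺ l rs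

  ∷ʳ-linked⁻ : ∀ {x} u → Linked R (u ∷ʳ x) → Linked R u × All (λ y → R y x) u
  ∷ʳ-linked⁻ [] _ = [] , []
  ∷ʳ-linked⁻ (y ∷ []) (r ∷ [-]) = [-] , r ∷ []
  ∷ʳ-linked⁻ (y ∷ z ∷ u) (r ∷ l) with l′ , z≤x ∷ rs ← ∷ʳ-linked⁻ (z ∷ u) l =
    r ∷ l′ , R-trans r z≤x ∷ z≤x ∷ rs

range-unique : ∀ n → Unique (range n)
range-unique n = Unique.applyUpTo⁺₁ suc n (λ i<j _ → <⇒≢ i<j ∘ suc-injective)

∈-range⇔ : ∀ {n x} → x ∈ range n ⇔ (1 ≤ x × x ≤ n)
∈-range⇔ {n} = mk⇔ to from
  where
  to : ∀ {x} → x ∈ range n → 1 ≤ x × x ≤ n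
  to x∈ with _ , i<n , refl ← ∈-applyUpTo⁻ suc x∈ = s≤s z≤n , i<n
  from : ∀ {x} → 1 ≤ x × x ≤ n → x ∈ range n
  from {suc i} (_ , i<n) = ∈-applyUpTo⁺ suc i<n

tuples-suc : ∀ n k → tuples n (suc k) ≡ cartesianProductWith _∷_ (range n) (tuples n k)
tuples-suc n k = concatMap-map≡cartesianProductWith _∷_ (range n) (tuples n k)

tuples-unique : ∀ n k → Unique (tuples n k)
tuples-unique n zero = [] AllPairs.∷ AllPairs.[]
tuples-unique n (suc k) rewrite tuples-suc n k =
  Unique.cartesianProductWith⁺ _∷_ ∷-injective (range-unique n) (tuples-unique n k)

Bounded : ℕ → List ℕ → Set
Bounded n = All (λ x → 1 ≤ x × x ≤ n)

∈-tuples⇔ : ∀ {n k t} → t ∈ tuples n k ⇔ (Bounded n t × length t ≡ k)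
∈-tuples⇔ {n} = mk⇔ to from
  where
  to : ∀ {k t} → t ∈ tuples n k → Bounded n t × length t ≡ k
  to {zero} (here refl) = [] , refl
  to {suc k} t∈ rewrite tuples-suc n k
    with x , u , x∈ , u∈ , refl ← ∈-cartesianProductWith⁻ _∷_ (range n) (tuples n k) t∈
    with bounded , refl ← to {k} u∈ = Equivalence.to ∈-range⇔ x∈ ∷ bounded , refl
  from : ∀ {k t} → Bounded n t × length t ≡ k → t ∈ tuples n k
  from {zero} {[]} _ = here refl
  from {suc k} {x ∷ u} (x-in ∷ bounded , refl) rewrite tuples-suc n k =
    ∈-cartesianProductWith⁺ _∷_ (Equivalence.from ∈-range⇔ x-in) (from (bounded , refl))

SortedTuple : ℕ → ℕ → List ℕ → Set
SortedTuple n k t = WeaklyIncreasing t × Bounded n t × length t ≡ k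

C-unique : ∀ n k → Unique (C n k)
C-unique n k = Unique.filter⁺ (linked? _≤?_) (tuples-unique n k)

∈-C⁻ : ∀ n k {t} → t ∈ C n k → SortedTuple n k t
∈-C⁻ n k t∈ with t∈tuples , sorted ← ∈-filter⁻ (linked? _≤?_) t∈ = sorted , Equivalence.to ∈-tuples⇔ t∈tuples

∈-C⁺ : ∀ n k {t} → SortedTuple n k t → t ∈ C n k
∈-C⁺ n k (sorted , bounded) = ∈-filter⁺ (linked? _≤?_) (Equivalence.from ∈-tuples⇔ bounded) sorted

SortedTuple-mono : ∀ {m n k t} → m ≤ n → SortedTuple m k t → SortedTuple n k t
SortedTuple-mono m≤n (sorted , bounded , len) = sorted , All.map (λ (1≤x , x≤m) → 1≤x , ≤-trans x≤m m≤n) bounded , len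

SortedTuple-∷ʳ-top : ∀ {m k u} → SortedTuple (suc m) k u → SortedTuple (suc m) (suc k) (u ∷ʳ suc m)
SortedTuple-∷ʳ-top {m} {u = u} (sorted , bounded , refl) =
  ∷ʳ-linked⁺ ≤-trans sorted (All.map proj₂ bounded) ,
  ∷ʳ⁺ bounded (s≤s z≤n , ≤-refl) ,
  length-∷ʳ u (suc m)

SortedTuple-split-top : ∀ {m k t} → SortedTuple (suc m) (suc k) t →
  SortedTuple m (suc k) t ⊎ ∃[ u ] SortedTuple (suc m) k u × t ≡ u ∷ʳ suc m
SortedTuple-split-top {m} {k} {t} st with initLast t
SortedTuple-split-top {m} {k} {.(u ∷ʳ x)} (sorted , bounded , len) | u ∷ʳ′ x
  with u-sorted , u≤x ← ∷ʳ-linked⁻ ≤-trans u sorted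
  with u-bounded , (1≤x , x≤1+m) ← ∷ʳ⁻ bounded
  with x ≟ suc m
... | yes refl = inj₂ (u , (u-sorted , u-bounded , suc-injective (trans (sym (length-∷ʳ u x)) len)) , refl)
... | no x≢1+m with s≤s x≤m ← ≤∧≢⇒< x≤1+m x≢1+m =
  inj₁ (sorted , ∷ʳ⁺ (All.zipWith (λ ((1≤y , _) , y≤x) → 1≤y , ≤-trans y≤x x≤m) (u-bounded , u≤x)) (1≤x , x≤m) , len)

C-suc-↭ : ∀ m k → C (suc m) (suc k) ↭ C m (suc k) ++ map (_∷ʳ suc m) (C (suc m) k)
C-suc-↭ m k = unique∧set⇒↭ (C-unique (suc m) (suc k))
  (Unique.++⁺ (C-unique m (suc k)) (Unique.map⁺ (∷ʳ-injectiveˡ _ _) (C-unique (suc m) k)) disjoint)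
  (mk⇔ to from)
  where
  to : ∀ {t} → t ∈ C (suc m) (suc k) → t ∈ C m (suc k) ++ map (_∷ʳ suc m) (C (suc m) k)
  to t∈ with SortedTuple-split-top (∈-C⁻ (suc m) (suc k) t∈)
  ... | inj₁ st = ∈-++⁺ˡ (∈-C⁺ m (suc k) st)
  ... | inj₂ (u , st , refl) = ∈-++⁺ʳ (C m (suc k)) (∈-map⁺ (_∷ʳ suc m) (∈-C⁺ (suc m) k st))
  from : ∀ {t} → t ∈ C m (suc k) ++ map (_∷ʳ suc m) (C (suc m) k) → t ∈ C (suc m) (suc k)
  from t∈ with ∈-++⁻ (C m (suc k)) t∈
  ... | inj₁ t∈ₗ = ∈-C⁺ (suc m) (suc k) (SortedTuple-mono (n≤1+n m) (∈-C⁻ m (suc k) t∈ₗ))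
  ... | inj₂ t∈ᵣ with u , u∈ , refl ← ∈-map⁻ (_∷ʳ suc m) t∈ᵣ =
    ∈-C⁺ (suc m) (suc k) (SortedTuple-∷ʳ-top (∈-C⁻ (suc m) k u∈))
  disjoint : ∀ {t} → ¬ (t ∈ C m (suc k) × t ∈ map (_∷ʳ suc m) (C (suc m) k))
  disjoint (t∈ₗ , t∈ᵣ) with u , _ , refl ← ∈-map⁻ (_∷ʳ suc m) t∈ᵣ
    with _ , bounded , _ ← ∈-C⁻ m (suc k) t∈ₗ
    with _ , (_ , 1+m≤m) ← ∷ʳ⁻ bounded = <-irrefl refl 1+m≤m

sortℕ-↭ : ∀ xs → sortℕ xs ↭ xs
sortℕ-↭ = SortingAlgorithm.sort-↭ mergeSort

sortℕ-sorted : ∀ xs → WeaklyIncreasing (sortℕ xs)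
sortℕ-sorted = SortingAlgorithm.sort-↗ mergeSort

sortℕ-↭-sorted : ∀ {xs ys} → WeaklyIncreasing ys → xs ↭ ys → sortℕ xs ≡ ys
sortℕ-↭-sorted {xs} ys↗ xs↭ys =
  ≋⇒≡ (↗↭↗⇒≋ ≤-totalOrder (sortℕ-sorted xs) ys↗ (↭⇒↭ₛ (↭-trans (sortℕ-↭ xs) xs↭ys)))

Fixed : (ℕ → ℕ) → List ℕ → Set
Fixed σ t = symPow σ t ≡ t

-- The very test used in the definition of f, so f ℓ n k ≡ length (filter (fixed? (cycle ℓ)) (C n k)) by refl.
fixed? : ∀ σ → Decidable (Fixed σ)
fixed? σ t = ≡-dec _≟_ (symPow σ t) t

symPow-fixed⇔ : ∀ σ {t} → WeaklyIncreasing t → Fixed σ t ⇔ (map σ t ↭ t)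
symPow-fixed⇔ σ {t} t↗ = mk⇔
  (λ fixed → ↭-trans (↭-sym (sortℕ-↭ (map σ t))) (↭-reflexive fixed))
  (sortℕ-↭-sorted t↗)

symPow-fixed-∷ʳ⇔ : ∀ σ {t x} → σ x ≡ x → WeaklyIncreasing (t ∷ʳ x) → Fixed σ (t ∷ʳ x) ⇔ Fixed σ t
symPow-fixed-∷ʳ⇔ σ {t} {x} σx≡x t∷ʳx↗ = mk⇔
  (λ fixed → Equivalence.from (symPow-fixed⇔ σ t↗) (drop (Equivalence.to (symPow-fixed⇔ σ t∷ʳx↗) fixed)))
  (λ fixed → Equivalence.from (symPow-fixed⇔ σ t∷ʳx↗) (add (Equivalence.to (symPow-fixed⇔ σ t↗) fixed)))
  where
  t↗ : WeaklyIncreasing t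
  t↗ = proj₁ (∷ʳ-linked⁻ ≤-trans t t∷ʳx↗)
  map-∷ʳ : map σ (t ∷ʳ x) ≡ map σ t ∷ʳ x
  map-∷ʳ = trans (map-++ σ t (x ∷ [])) (cong (map σ t ∷ʳ_) σx≡x)
  add : map σ t ↭ t → map σ (t ∷ʳ x) ↭ t ∷ʳ x
  add σt↭t = ↭-trans (↭-reflexive map-∷ʳ) (↭.++⁺ʳ (x ∷ []) σt↭t)
  drop : map σ (t ∷ʳ x) ↭ t ∷ʳ x → map σ t ↭ t
  drop σtx↭tx = ↭.drop-∷ (↭-trans (↭.∷↭∷ʳ x (map σ t))
    (↭-trans (↭-reflexive (sym map-∷ʳ)) (↭-trans σtx↭tx (↭-sym (↭.∷↭∷ʳ x t)))))

cycle-fixes-outside : ∀ {ℓ x} → ℓ < x → cycle ℓ x ≡ x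
cycle-fixes-outside {ℓ} {x} ℓ<x
  rewrite dec-false (x <? ℓ) (<-asym ℓ<x) | dec-false (x ≟ ℓ) (λ x≡ℓ → <-irrefl (sym x≡ℓ) ℓ<x)
  with does (1 ≤? x)
... | true = refl
... | false = refl

cycle-shifts : ∀ {ℓ x} → 1 ≤ x → x < ℓ → cycle ℓ x ≡ suc x
cycle-shifts {ℓ} {x} 1≤x x<ℓ rewrite dec-true (1 ≤? x) 1≤x | dec-true (x <? ℓ) x<ℓ = refl

cycle-wraps : ∀ L → cycle (suc L) (suc L) ≡ 1
cycle-wraps L rewrite dec-false (suc L <? suc L) (<-irrefl refl) | dec-true (suc L ≟ suc L) refl = refl

f-suc-suc : ∀ ℓ m k → ℓ ≤ m → f ℓ (suc m) (suc k) ≡ f ℓ m (suc k) + f ℓ (suc m) k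
f-suc-suc ℓ m k ℓ≤m = begin
    length (filter F (C (suc m) (suc k)))
  ≡⟨ ↭.↭-length (↭.filter-↭ F (C-suc-↭ m k)) ⟩
    length (filter F (C m (suc k) ++ map (_∷ʳ suc m) (C (suc m) k)))
  ≡⟨ cong length (filter-++ F (C m (suc k)) _) ⟩
    length (filter F (C m (suc k)) ++ filter F (map (_∷ʳ suc m) (C (suc m) k)))
  ≡⟨ length-++ (filter F (C m (suc k))) ⟩
    f ℓ m (suc k) + length (filter F (map (_∷ʳ suc m) (C (suc m) k)))
  ≡⟨ cong (λ ys → f ℓ m (suc k) + length ys) (filter-map-⇔ F F (_∷ʳ suc m) (All.tabulate appending-top-keeps-fixed)) ⟩
    f ℓ m (suc k) + length (map (_∷ʳ suc m) (filter F (C (suc m) k)))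
  ≡⟨ cong (f ℓ m (suc k) +_) (length-map (_∷ʳ suc m) (filter F (C (suc m) k))) ⟩
    f ℓ m (suc k) + f ℓ (suc m) k
  ∎
  where
  open ≡-Reasoning
  F : Decidable (Fixed (cycle ℓ))
  F = fixed? (cycle ℓ)
  appending-top-keeps-fixed : ∀ {u} → u ∈ C (suc m) k → Fixed (cycle ℓ) (u ∷ʳ suc m) ⇔ Fixed (cycle ℓ) u
  appending-top-keeps-fixed u∈ =
    symPow-fixed-∷ʳ⇔ (cycle ℓ) (cycle-fixes-outside (s≤s ℓ≤m)) (proj₁ (SortedTuple-∷ʳ-top (∈-C⁻ (suc m) k u∈)))

fromMultiplicities : ℕ → List ℕ → List ℕ
fromMultiplicities s [] = []
fromMultiplicities s (c ∷ v) = replicate c s ++ fromMultiplicities (suc s) v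

replicate-linked : ∀ c {s r} → Linked _≤_ (s ∷ r) → Linked _≤_ (s ∷ replicate c s ++ r)
replicate-linked zero sr = sr
replicate-linked (suc c) sr = ≤-refl ∷ replicate-linked c sr

linked-weaken-head : ∀ {a b r} → a ≤ b → Linked _≤_ (b ∷ r) → Linked _≤_ (a ∷ r)
linked-weaken-head a≤b [-] = [-]
linked-weaken-head a≤b (b≤c ∷ l) = ≤-trans a≤b b≤c ∷ l

fromMultiplicities-sorted : ∀ s v → Linked _≤_ (s ∷ fromMultiplicities s v)
fromMultiplicities-sorted s [] = [-]
fromMultiplicities-sorted s (c ∷ v) =
  replicate-linked c (linked-weaken-head (n≤1+n s) (fromMultiplicities-sorted (suc s) v))

fromMultiplicities-< : ∀ s v → All (_< s + length v) (fromMultiplicities s v)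
fromMultiplicities-< s [] = []
fromMultiplicities-< s (c ∷ v) rewrite +-suc s (length v) =
  ++⁺ (replicate⁺ c (s≤s (m≤m+n s (length v)))) (fromMultiplicities-< (suc s) v)

split-run : ∀ s t → Linked _≤_ (s ∷ t) → ∃[ c ] ∃[ u ] t ≡ replicate c s ++ u × Linked _≤_ (suc s ∷ u)
split-run s [] _ = 0 , [] , refl , [-]
split-run s (x ∷ t) (s≤x ∷ sorted) with x ≟ s
... | yes refl with c , u , refl , u-sorted ← split-run s t sorted = suc c , u , refl , u-sorted
... | no x≢s = 0 , x ∷ t , refl , ≤∧≢⇒< s≤x (x≢s ∘ sym) ∷ sorted

fromMultiplicities-surjective : ∀ s m {t} → Linked _≤_ (s ∷ t) → All (_< s + m) t →
  ∃[ v ] length v ≡ m × t ≡ fromMultiplicities s v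
fromMultiplicities-surjective s zero {[]} _ _ = [] , refl , refl
fromMultiplicities-surjective s zero {x ∷ t} (s≤x ∷ _) (x<s+0 ∷ _) =
  ⊥-elim (<-irrefl refl (≤-trans x<s+0 (subst (_≤ x) (sym (+-identityʳ s)) s≤x)))
fromMultiplicities-surjective s (suc m) {t} sorted t<
  with c , u , refl , u-sorted ← split-run s t sorted
  with v , len , refl ← fromMultiplicities-surjective (suc s) m u-sorted
                          (subst (λ b → All (_< b) u) (+-suc s m) (++⁻ʳ (replicate c s) t<))
  = c ∷ v , cong suc len , refl

replicate-++-injective : ∀ {s u u′} c d → Linked _≤_ (suc s ∷ u) → Linked _≤_ (suc s ∷ u′) →
  replicate c s ++ u ≡ replicate d s ++ u′ → c ≡ d × u ≡ u′
replicate-++-injective zero zero _ _ eq = refl , eq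
replicate-++-injective (suc c) (suc d) u↗ u′↗ eq
  with c≡d , u≡u′ ← replicate-++-injective c d u↗ u′↗ (∷-injectiveʳ eq) = cong suc c≡d , u≡u′
replicate-++-injective zero (suc d) (1+s≤s ∷ _) _ refl = ⊥-elim (<-irrefl refl 1+s≤s)
replicate-++-injective (suc c) zero _ (1+s≤s ∷ _) refl = ⊥-elim (<-irrefl refl 1+s≤s)

fromMultiplicities-injective : ∀ s {v w} → length v ≡ length w →
  fromMultiplicities s v ≡ fromMultiplicities s w → v ≡ w
fromMultiplicities-injective s {[]} {[]} _ _ = refl
fromMultiplicities-injective s {c ∷ v} {d ∷ w} len eq
  with refl , rest ← replicate-++-injective c d (fromMultiplicities-sorted (suc s) v) (fromMultiplicities-sorted (suc s) w) eq
  = cong (c ∷_) (fromMultiplicities-injective (suc s) (suc-injective len) rest)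

fromMultiplicities-∷ʳ : ∀ s v c → fromMultiplicities s (v ∷ʳ c) ≡ fromMultiplicities s v ++ replicate c (s + length v)
fromMultiplicities-∷ʳ s [] c rewrite +-identityʳ s = ++-identityʳ (replicate c s)
fromMultiplicities-∷ʳ s (d ∷ v) c rewrite fromMultiplicities-∷ʳ (suc s) v c | +-suc s (length v) =
  sym (++-assoc (replicate d s) _ _)

map-suc-fromMultiplicities : ∀ s v → map suc (fromMultiplicities s v) ≡ fromMultiplicities (suc s) v
map-suc-fromMultiplicities s [] = refl
map-suc-fromMultiplicities s (c ∷ v) rewrite map-++ suc (replicate c s) (fromMultiplicities (suc s) v) =
  cong₂ _++_ (map-replicate suc c s) (map-suc-fromMultiplicities (suc s) v)

symPow-cycle-rotates : ∀ {L} v c → length v ≡ L →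
  symPow (cycle (suc L)) (fromMultiplicities 1 (v ∷ʳ c)) ≡ fromMultiplicities 1 (c ∷ v)
symPow-cycle-rotates {L} v c refl = sortℕ-↭-sorted (Linked.tail (fromMultiplicities-sorted 1 (c ∷ v))) (begin
    map σ (fromMultiplicities 1 (v ∷ʳ c))
  ≡⟨ cong (map σ) (fromMultiplicities-∷ʳ 1 v c) ⟩
    map σ (fromMultiplicities 1 v ++ replicate c (suc L))
  ≡⟨ map-++ σ (fromMultiplicities 1 v) _ ⟩
    map σ (fromMultiplicities 1 v) ++ map σ (replicate c (suc L))
  ≡⟨ cong₂ _++_ (map-cong-local (All.map (λ (1≤x , x<) → cycle-shifts 1≤x x<) in-range)) (map-replicate σ c (suc L)) ⟩
    map suc (fromMultiplicities 1 v) ++ replicate c (σ (suc L))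
  ≡⟨ cong₂ _++_ (map-suc-fromMultiplicities 1 v) (cong (replicate c) (cycle-wraps L)) ⟩
    fromMultiplicities 2 v ++ replicate c 1
  ↭⟨ ↭.++-comm (fromMultiplicities 2 v) (replicate c 1) ⟩
    fromMultiplicities 1 (c ∷ v)
  ∎)
  where
  open PermutationReasoning
  σ : ℕ → ℕ
  σ = cycle (suc L)
  in-range : All (λ x → 1 ≤ x × x < suc L) (fromMultiplicities 1 v)
  in-range = All.zip (∷-linked⇒All ≤-trans (fromMultiplicities-sorted 1 v) , fromMultiplicities-< 1 v)

block : ℕ → ℕ → List ℕ
block ℓ b = fromMultiplicities 1 (replicate ℓ b)

block-SortedTuple : ∀ ℓ b → SortedTuple ℓ (b * ℓ) (block ℓ b)
block-SortedTuple ℓ b =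
  Linked.tail (fromMultiplicities-sorted 1 (replicate ℓ b)) ,
  All.zipWith (λ {x} (1≤x , x<) → 1≤x , ≤-pred (subst (x <_) (cong suc (length-replicate ℓ)) x<))
    (∷-linked⇒All ≤-trans (fromMultiplicities-sorted 1 (replicate ℓ b)) , fromMultiplicities-< 1 (replicate ℓ b)) ,
  length-fromMultiplicities-replicate 1 ℓ
  where
  length-fromMultiplicities-replicate : ∀ s ℓ → length (fromMultiplicities s (replicate ℓ b)) ≡ b * ℓ
  length-fromMultiplicities-replicate s zero = sym (*-zeroʳ b)
  length-fromMultiplicities-replicate s (suc ℓ)
    rewrite length-++ (replicate b s) {fromMultiplicities (suc s) (replicate ℓ b)} | *-suc b ℓ =
    cong₂ _+_ (length-replicate b) (length-fromMultiplicities-replicate (suc s) ℓ)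

block-fixed : ∀ L b → Fixed (cycle (suc L)) (block (suc L) b)
block-fixed L b = begin
    symPow (cycle (suc L)) (fromMultiplicities 1 (b ∷ replicate L b))
  ≡⟨ cong (symPow (cycle (suc L)) ∘ fromMultiplicities 1) (sym (replicate-∷ʳ L b)) ⟩
    symPow (cycle (suc L)) (fromMultiplicities 1 (replicate L b ∷ʳ b))
  ≡⟨ symPow-cycle-rotates (replicate L b) b (length-replicate L) ⟩
    fromMultiplicities 1 (b ∷ replicate L b)
  ∎
  where open ≡-Reasoning

fixed⇒block : ∀ {L k t} → SortedTuple (suc L) k t → Fixed (cycle (suc L)) t → ∃[ b ] t ≡ block (suc L) b
fixed⇒block {L} (sorted , bounded , _) fixed
  with w , len-w , refl ← fromMultiplicities-surjective 1 (suc L)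
                            (∷-linked⁺ (All.map proj₁ bounded) sorted) (All.map (s≤s ∘ proj₂) bounded)
  with initLast w
... | v ∷ʳ′ c = c , cong (fromMultiplicities 1) (begin
    v ∷ʳ c                       ≡⟨ sym c∷v≡v∷ʳc ⟩
    c ∷ v                        ≡⟨ ∷≡∷ʳ⇒replicate c v c∷v≡v∷ʳc ⟩
    replicate (suc (length v)) c ≡⟨ cong (λ n → replicate (suc n) c) len-v ⟩
    replicate (suc L) c          ∎)
  where
  open ≡-Reasoning
  len-v : length v ≡ L
  len-v = suc-injective (trans (sym (length-∷ʳ v c)) len-w)
  c∷v≡v∷ʳc : c ∷ v ≡ v ∷ʳ c
  c∷v≡v∷ʳc = fromMultiplicities-injective 1 (sym (length-∷ʳ v c))
    (trans (sym (symPow-cycle-rotates v c len-v)) fixed)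

fixed⇒block-length : ∀ {L k t} → SortedTuple (suc L) k t → Fixed (cycle (suc L)) t →
  ∃[ b ] t ≡ block (suc L) b × k ≡ b * suc L
fixed⇒block-length {L} st@(_ , _ , refl) fixed with b , refl ← fixed⇒block st fixed =
  b , refl , proj₂ (proj₂ (block-SortedTuple (suc L) b))

f-diagonal-∤ : ∀ L k → ¬ (suc L ∣ k) → f (suc L) (suc L) k ≡ 0
f-diagonal-∤ L k ℓ∤k = cong length (filter-none (fixed? (cycle (suc L))) (All.tabulate not-fixed))
  where
  not-fixed : ∀ {t} → t ∈ C (suc L) k → ¬ Fixed (cycle (suc L)) t
  not-fixed t∈ fixed with b , _ , k≡ ← fixed⇒block-length (∈-C⁻ (suc L) k t∈) fixed = ℓ∤k (divides b k≡)

f-diagonal-∣ : ∀ L k → suc L ∣ k → f (suc L) (suc L) k ≡ 1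
f-diagonal-∣ L k (divides q refl) = ↭.↭-length (unique∧set⇒↭
  (Unique.filter⁺ F (C-unique (suc L) k)) (All.[] AllPairs.∷ AllPairs.[]) (mk⇔ to from))
  where
  F : Decidable (Fixed (cycle (suc L)))
  F = fixed? (cycle (suc L))
  to : ∀ {t} → t ∈ filter F (C (suc L) k) → t ∈ block (suc L) q ∷ []
  to t∈ with t∈C , fixed ← ∈-filter⁻ F t∈
        with b , refl , k≡ ← fixed⇒block-length (∈-C⁻ (suc L) k t∈C) fixed =
    here (cong (block (suc L)) (*-cancelʳ-≡ b q (suc L) (sym k≡)))
  from : ∀ {t} → t ∈ block (suc L) q ∷ [] → t ∈ filter F (C (suc L) k)
  from (here refl) = ∈-filter⁺ F (∈-C⁺ (suc L) k (block-SortedTuple (suc L) q)) (block-fixed L q)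

-- The second summand f ℓ n 0 of the recursion computes to 1.
f-one : ∀ L → 1 < suc L → ∀ d → f (suc L) (d + suc L) 1 ≡ d
f-one L 1<ℓ zero = f-diagonal-∤ L 1 (λ ℓ∣1 → <-irrefl (sym (∣1⇒≡1 ℓ∣1)) 1<ℓ)
f-one L 1<ℓ (suc d) rewrite f-suc-suc (suc L) (d + suc L) 0 (m≤n+m (suc L) d) | f-one L 1<ℓ d = +-comm d 1

theorem3p4 : ∀ (ℓ : ℕ) → 1 < ℓ → ∀ (n k : ℕ) → ℓ ≤ n → 1 ≤ k →
      (k ≡ 1 → f ℓ n k ≡ n ∸ ℓ)
    × (n ≡ ℓ → ℓ ∣ k → f ℓ n k ≡ 1)
    × (n ≡ ℓ → ¬ (ℓ ∣ k) → f ℓ n k ≡ 0)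
    × (1 < k → ℓ < n → f ℓ n k ≡ f ℓ (n ∸ 1) k + f ℓ n (k ∸ 1))
theorem3p4 (suc L) 1<ℓ n k ℓ≤n _ =
  (λ { refl → subst (λ m → f (suc L) m 1 ≡ n ∸ suc L) (m∸n+n≡m ℓ≤n) (f-one L 1<ℓ (n ∸ suc L)) }) ,
  (λ { refl → f-diagonal-∣ L k }) ,
  (λ { refl → f-diagonal-∤ L k }) ,
  recursion n k
  where
  recursion : ∀ n k → 1 < k → suc L < n → f (suc L) n k ≡ f (suc L) (n ∸ 1) k + f (suc L) n (k ∸ 1)
  recursion (suc m) (suc k) _ (s≤s ℓ≤m) = f-suc-suc (suc L) m k ℓ≤m
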